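{- Let $H=(H^\bullet,H^\times)$ be a hypergraph and $\mathcal{H}$ the set of its subhypergraphs. For all $X,Y\in\mathcal{H}$, $[\delta,\Delta](X)\subseteq Y$ if and only if $X\subseteq[\epsilon,\varepsilon](Y)$; that is, $([\epsilon,\varepsilon],[\delta,\Delta])$ is an adjunction on $(\mathcal{H},\subseteq)$.
   Context: A hypergraph is a pair $H=(H^\bullet,H^\times)$ where $H^\bullet$ is a set of vertices and $H^\times=(e_i)_{i\in I}$ is a family of hyperedges indexed by a finite set $I$, each hyperedge $e$ having a vertex set $v(e)\subseteq H^\bullet$. Subsets of $H^\times$ are subfamilies $X^\times=(e_j)_{j\in J}$, $J\subseteq I$. A subhypergraph of $H$ is a pair $X=(X^\bullet,X^\times)$ with $X^\bullet\subseteq H^\bullet$, $X^\times\subseteq H^\times$ and $v(e)\subseteq X^\bullet$ for every $e\in X^\times$; $X\subseteq Y$ means componentwise inclusion. Operators: $\delta^\bullet(X^\times)=\bigcup_{j\in J}v(e_j)$; $\epsilon^\bullet(X^\times)=\bigcap_{i\in I\setminus J}\overline{v(e_i)}$ (complement in $H^\bullet$); $\epsilon^\times(X^\bullet)=\{e_i\mid v(e_i)\subseteq X^\bullet\}$; $\delta^\times(X^\bullet)=\{e_i\mid v(e_i)\cap X^\bullet\neq\emptyset\}$; $\delta=\delta^\bullet\circ\delta^\times$, $\epsilon=\epsilon^\bullet\circ\epsilon^\times$; $\Delta=\delta^\times\circ\delta^\bullet$, $\varepsilon=\epsilon^\times\circ\epsilon^\bullet$; $[\delta,\Delta](X)=(\delta(X^\bullet),\Delta(X^\times))$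 and $[\epsilon,\varepsilon](X)=(\epsilon(X^\bullet),\varepsilon(X^\times))$. -}

module Defs where

open import Level using (0ℓ)
open import Data.Nat using (ℕ)
open import Data.Fin using (Fin)
open import Data.Product using (Σ; _×_)
open import Relation.Nullary using (¬_)
open import Relation.Unary using (Pred; _∈_; _∉_; _⊆_)

-- A hypergraph: vertex set V (an arbitrary type), hyperedges indexed by Fin n
-- (a finite index set I), each hyperedge i having vertex set v i ⊆ V.
record Hypergraph : Set₁ where
  field
    V : Set
    n : ℕ
    v : Fin n → Pred V 0ℓ

module _ (H : Hypergraph) where
  open Hypergraph H

  VSet : Set₁
  VSet = Pred V 0ℓ

  ESet : Set₁
  ESet = Pred (Fin n) 0ℓ

  record Pair : Set₁ where
    constructor ⟨_,_⟩
    field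
      vert  : VSet
      edges : ESet

  IsSubhypergraph : Pair → Set
  IsSubhypergraph ⟨ Xv , Xe ⟩ = ∀ i → i ∈ Xe → v i ⊆ Xv

  record Subhypergraph : Set₁ where
    field
      pair  : Pair
      isSub : IsSubhypergraph pair

  ⊑ : Pair → Pair → Set
  ⊑ ⟨ Xv , Xe ⟩ ⟨ Yv , Ye ⟩ = (Xv ⊆ Yv) × (Xe ⊆ Ye)

  δ• : ESet → VSet
  δ• J x = Σ (Fin n) λ j → j ∈ J × x ∈ v j

  ε• : ESet → VSet
  ε• J x = ∀ i → i ∉ J → x ∉ v i

  ε× : VSet → ESet
  ε× S i = v i ⊆ S

  δ× : VSet → ESet
  δ× S i = Σ V λ x → x ∈ v i × x ∈ S

  δ : VSet → VSet
  δ S = δ• (δ× S)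

  ε : VSet → VSet
  ε S = ε• (ε× S)

  Δ : ESet → ESet
  Δ J = δ× (δ• J)

  ε' : ESet → ESet
  ε' J = ε× (ε• J)

  [δ,Δ] : Pair → Pair
  [δ,Δ] ⟨ Xv , Xe ⟩ = ⟨ δ Xv , Δ Xe ⟩

  [ε,ε'] : Pair → Pair
  [ε,ε'] ⟨ Xv , Xe ⟩ = ⟨ ε Xv , ε' Xe ⟩

module Submission where

-- The adjunction ([ε,ε'], [δ,Δ]) on subhypergraphs splits componentwise
-- into two Galois connections, one on vertex sets (δ ⊣ ε) and one on
-- hyperedge families (Δ ⊣ ε').  Each of them is a composite of the two
-- elementary Galois connections relating vertex sets and hyperedge families:
--
--   δ•(J) ⊆ S  ⇔  J ⊆ ε×(S)      (constructive), and
--   δ×(S) ⊆ J  ⇔  S ⊆ ε•(J)      (uses excluded middle for membership in J).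
--
-- Since δ = δ• ∘ δ×, ε = ε• ∘ ε×, Δ = δ× ∘ δ• and ε' = ε× ∘ ε•, chaining the
-- two elementary equivalences in either order gives δ ⊣ ε and Δ ⊣ ε'; pairing
-- them gives [δ,Δ] ⊣ [ε,ε'] for arbitrary pairs (X•, X×).

open import Defs
open import Level using (0ℓ)
open import Axiom.ExcludedMiddle using (ExcludedMiddle)
open import Axiom.DoubleNegationElimination using (em⇒dne)
open import Function.Bundles using (_⇔_; mk⇔)
open import Function.Properties.Equivalence using (trans)
open import Data.Product using (_,_)
open import Data.Product.Function.NonDependent.Propositional using (_×-⇔_)
open import Relation.Unary using (_⊆_)

module _ (H : Hypergraph) where

  δ•⊣ε× : (J : ESet H) (S : VSet H) → (δ• H J ⊆ S) ⇔ (J ⊆ ε× H S)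
  δ•⊣ε× J S = mk⇔
    (λ δ•J⊆S {j} j∈J {x} x∈vj → δ•J⊆S (j , j∈J , x∈vj))
    (λ { J⊆ε×S (j , j∈J , x∈vj) → J⊆ε×S j∈J x∈vj })

  -- The backward direction only yields ¬¬(i ∈ J),
  -- so it is closed by double negation elimination.
  δ×⊣ε• : ExcludedMiddle 0ℓ → (S : VSet H) (J : ESet H) →
          (δ× H S ⊆ J) ⇔ (S ⊆ ε• H J)
  δ×⊣ε• em S J = mk⇔
    (λ δ×S⊆J {x} x∈S i i∉J x∈vi → i∉J (δ×S⊆J (x , x∈vi , x∈S)))
    (λ { S⊆ε•J {i} (x , x∈vi , x∈S) →
           em⇒dne em (λ i∉J → S⊆ε•J x∈S i i∉J x∈vi) })

  δ⊣ε : ExcludedMiddle 0ℓ → (S T : VSet H) → (δ H S ⊆ T) ⇔ (S ⊆ ε H T)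
  δ⊣ε em S T = trans (δ•⊣ε× (δ× H S) T) (δ×⊣ε• em S (ε× H T))

  Δ⊣ε' : ExcludedMiddle 0ℓ → (J K : ESet H) → (Δ H J ⊆ K) ⇔ (J ⊆ ε' H K)
  Δ⊣ε' em J K = trans (δ×⊣ε• em (δ• H J) K) (δ•⊣ε× J (ε• H K))

  [δ,Δ]⊣[ε,ε'] : ExcludedMiddle 0ℓ → (P Q : Pair H) →
                 ⊑ H ([δ,Δ] H P) Q ⇔ ⊑ H P ([ε,ε'] H Q)
  [δ,Δ]⊣[ε,ε'] em ⟨ Xv , Xe ⟩ ⟨ Yv , Ye ⟩ = δ⊣ε em Xv Yv ×-⇔ Δ⊣ε' em Xe Ye

theorem2 : ExcludedMiddle 0ℓ → (H : Hypergraph) → (X Y : Subhypergraph H) →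
    ⊑ H ([δ,Δ] H (Subhypergraph.pair X)) (Subhypergraph.pair Y)
      ⇔ ⊑ H (Subhypergraph.pair X) ([ε,ε'] H (Subhypergraph.pair Y))
theorem2 em H X Y =
  [δ,Δ]⊣[ε,ε'] H em (Subhypergraph.pair X) (Subhypergraph.pair Y)
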